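{- Let $Q=2^m$, let $a,b,c\in\mathbb F_Q$ and $\epsilon\in\{1,-1\}$, and put $\epsilon'=(-1)^{\mathrm{Tr}(c)}\epsilon$. Then $\pi^c_{a,b}(\epsilon)=\pi^c_{b,a}(\epsilon')$ and $p^c_{a,b}(\epsilon)=p^c_{b,a}(\epsilon')$.
   Context: Let $Q=2^m$ and work in $\mathrm{PG}(2,Q)$. Conic and lines. - Points are nonzero vectors $(X,Y,Z)^\top$ up to scalars, and $(a,b,c)^\perp$ denotes the line $aX+bY+cZ=0$. - The conic is $\mathcal O=\{(\xi,\xi^2,1)^\top:\xi\in\mathbb F_Q\}\cup\{(0,1,0)^\top\}$. - The non-tangent lines (meeting $\mathcal O$ in $0$ or $2$ points) are exactly the lines $(1,x,y)^\perp$, $x,y\in\mathbb F_Q$; let $\mathcal L$ be their set. - Such a line lies in $\mathcal L_1$ (secant) if $\mathrm{Tr}(xy)=0$ and in $\mathcal L_{ -1}$ (exterior) if $\mathrm{Tr}(xy)=1$, where $\mathrm{Tr}$ is the absolute trace $\mathbb F_Q\to\mathbb F_2$. Modified cross-ratio. - For $\ell=(1,x,y)^\perp$ and $n=(1,z,u)^\perp$: $\hat\rho(\ell,n)=x^2u^2+y^2z^2+(x+z)(y+u)$. Counting numbers. - For distinct $\ell,m\in\mathcal L$ with $\ell\in\mathcal L_\epsilon$ and $\hat\rho(\ell,m)=c$: - $\pi^c_{a,b}(\epsilon)$ is the number of $n\in\mathcal L$ with $\hat\rho(\ell,n)=a$ and $\hat\rho(n,m)=b$; - $p^c_{a,b}(\epsilon)$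 is the same count restricted to $n\notin\{\ell,m\}$. - These numbers depend only on $a,b,c,\epsilon$ and not on the choice of $(\ell,m)$. Such pairs $(\ell,m)$ lie in a single orbit of the stabilizer of $\mathcal O$ in $\mathrm{PGL}(3,Q)$, which preserves $\hat\rho$. - If no such pair exists, the number is $0$. -}

module Defs where

open import Level using (0ℓ)
open import Data.Nat using (ℕ; zero; suc; _^_)
open import Data.Bool using (Bool; true; false; _∧_; not; if_then_else_)
open import Data.Product using (_×_; _,_; ∃)
open import Data.Maybe using (Maybe; just; nothing)
open import Data.List using (List; length; filterᵇ; cartesianProduct; head)
open import Data.List.Membership.Propositional using (_∈_)
open import Data.List.Relation.Unary.Unique.Propositional using (Unique)
open import Data.Sign using (Sign; opposite) renaming (+ to pos; - to neg)
open import Relation.Nullary using (¬_; Dec; does)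
open import Relation.Binary.PropositionalEquality using (_≡_)
open import Algebra.Structures using (IsCommutativeRing)

-- A finite field of order Q = 2^m (characteristic 2), with an explicit
-- enumeration of its elements (so that counts are computable).
record GF2^ (m : ℕ) : Set₁ where
  infixl 6 _+_
  infixl 7 _*_
  field
    F      : Set
    _+_    : F → F → F
    _*_    : F → F → F
    -_     : F → F
    0#     : F
    1#     : F
    isCommutativeRing : IsCommutativeRing _≡_ _+_ _*_ -_ 0# 1#
    0≢1    : ¬ (0# ≡ 1#)
    inverse : ∀ x → ¬ (x ≡ 0#) → ∃ λ y → x * y ≡ 1#
    char2  : 1# + 1# ≡ 0#
    _≟_    : (x y : F) → Dec (x ≡ y)
    elems  : List F
    complete : ∀ x → x ∈ elems
    unique : Unique elems
    card   : length elems ≡ 2 ^ m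

module GF {m : ℕ} (K : GF2^ m) where
  open GF2^ K

  _==_ : F → F → Bool
  x == y = does (x ≟ y)

  sq : F → F
  sq x = x * x

  trAux : ℕ → F → F
  trAux zero    x = 0#
  trAux (suc k) x = x + trAux k (sq x)

  Tr : F → F
  Tr = trAux m

  -- Non-tangent lines (1,x,y)^⊥ represented by (x , y)
  Line : Set
  Line = F × F

  lines : List Line
  lines = cartesianProduct elems elems

  _==L_ : Line → Line → Bool
  (x , y) ==L (z , u) = (x == z) ∧ (y == u)

  -- ℓ ∈ L_ε : ε = +1 (secant) iff Tr(xy) = 0, ε = -1 (exterior) iff Tr(xy) = 1
  inClass : Line → Sign → Bool
  inClass (x , y) pos = Tr (x * y) == 0#
  inClass (x , y) neg = Tr (x * y) == 1#

  ρ̂ : Line → Line → F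
  ρ̂ (x , y) (z , u) = sq x * sq u + sq y * sq z + (x + z) * (y + u)

  ε′ : F → Sign → Sign
  ε′ c ε = if Tr c == 0# then ε else opposite ε

  countπ : F → F → Line → Line → ℕ
  countπ a b ℓ n₀ =
    length (filterᵇ (λ n → (ρ̂ ℓ n == a) ∧ (ρ̂ n n₀ == b)) lines)

  countp : F → F → Line → Line → ℕ
  countp a b ℓ n₀ =
    length (filterᵇ (λ n → (ρ̂ ℓ n == a) ∧ (ρ̂ n n₀ == b)
                           ∧ not (n ==L ℓ) ∧ not (n ==L n₀)) lines)

  -- some pair (ℓ, m) of distinct lines with ℓ ∈ L_ε and ρ̂(ℓ,m) = c, if any
  -- (the counts do not depend on the choice; we take the first one)
  chosenPair : F → Sign → Maybe (Line × Line)
  chosenPair c ε =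
    head (filterᵇ (λ { (ℓ , n) → not (ℓ ==L n) ∧ inClass ℓ ε ∧ (ρ̂ ℓ n == c) })
                  (cartesianProduct lines lines))

  π : F → F → F → Sign → ℕ
  π a b c ε with chosenPair c ε
  ... | just (ℓ , n) = countπ a b ℓ n
  ... | nothing      = 0

  p : F → F → F → Sign → ℕ
  p a b c ε with chosenPair c ε
  ... | just (ℓ , n) = countp a b ℓ n
  ... | nothing      = 0

-- Exchanging a and b in the count through (ℓ, m) is, by the symmetry of ρ̂, the count
-- through (m, ℓ); and m ∈ 𝓛_ε′ because Tr ρ̂(ℓ, m) = Tr(xy) + Tr(zu) for ℓ = (1,x,y)^⊥,
-- m = (1,z,u)^⊥. It remains that the count does not depend on the chosen pair. The
-- stabiliser of 𝒪 preserves ρ̂ and the counts, and it carries every pair (ℓ, m) with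
-- ℓ ∈ 𝓛_ε, ρ̂(ℓ, m) = c to ((0,0), (1,c)) if ε = 1 and to ((1,t), (1,t+√c)) if ε = −1,
-- where Tr t = 1. These reductions rest on x^Q = x, on the existence of an element of
-- trace 1, and on the solvability of β² + β = s whenever Tr s = 0.
module Submission where

open import Defs
open import Level using (0ℓ)
open import Data.Nat as ℕ using (ℕ; zero; suc; _≤_; _<_; z≤n; s≤s)
import Data.Nat.Properties as ℕ
open import Data.Nat.GeneralisedArithmetic using (iterate)
open import Data.Bool using (Bool; true; false; T; not; _∧_; _xor_)
open import Data.Bool.Properties using (∧-comm; ∧-commutativeMonoid)
open import Data.Unit using (tt)
open import Data.Empty using (⊥-elim)
open import Data.Product using (Σ; ∃; _×_; _,_; proj₁; proj₂; uncurry; swap)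
open import Data.Sum using (_⊎_; inj₁; inj₂; [_,_]′)
open import Data.Maybe using (Maybe; just; nothing; maybe′)
open import Data.Sign using (Sign; opposite) renaming (+ to pos; - to neg)
open import Data.List using (List; []; _∷_; length; map; foldr; filterᵇ; head; cartesianProduct)
open import Data.List.Properties using (length-map)
open import Data.List.Membership.Propositional using (_∈_)
open import Data.List.Membership.Propositional.Properties
  using (∈-map⁺; ∈-map⁻; ∈-filter⁺; ∈-filter⁻; ∈-cartesianProduct⁺; ∈-length)
open import Data.List.Membership.Propositional.Properties.WithK using (unique∧set⇒bag)
import Data.List.Relation.Unary.Any as Any
open import Data.List.Relation.Unary.Any using (here; there; any?)
open import Data.List.Membership.Propositional using (lose)
import Data.List.Relation.Unary.All as All
open import Data.List.Relation.Unary.Unique.Propositional using (Unique; _∷_)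
import Data.List.Relation.Unary.Unique.Propositional.Properties as Unique
open import Data.List.Relation.Binary.BagAndSetEquality using (∼bag⇒↭)
open import Data.List.Relation.Binary.Permutation.Propositional using (_↭_; ↭⇒↭ₛ)
open import Data.List.Relation.Binary.Permutation.Propositional.Properties using (↭-length)
import Data.List.Relation.Binary.Permutation.Setoid.Properties as Permutation
open import Function using (_∘_; const)
open import Function.Bundles using (_⇔_; mk⇔; Equivalence; _↔_; Inverse; Injection; mk↔ₛ′)
open import Function.Properties.Inverse using (↔⇒↣)
open import Function.Construct.Composition using (_↔-∘_)
open import Function.Construct.Symmetry using (↔-sym)
open import Function.Construct.Identity using (↔-id)
open import Relation.Nullary using (¬_; Dec; yes; no; does; _×-dec_; ¬?)
import Relation.Nullary.Decidable as Dec
open import Relation.Nullary.Decidable using (T?; dec-true; dec-false; does-⇔)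
open import Relation.Binary.PropositionalEquality
open import Algebra.Bundles using (CommutativeMonoid; CommutativeRing; CommutativeSemiring; RawRing)
open import Algebra.Structures using (IsCommutativeRing)
open import Algebra.Solver.Ring.AlmostCommutativeRing
  using (fromCommutativeRing; _-Raw-AlmostCommutative⟶_)
import Algebra.Solver.Ring as RingSolver
import Algebra.Definitions.RawSemiring as RawSemiring
import Algebra.Properties.CommutativeSemiring.Exp as Exp
open import Algebra.Properties.CommutativeSemigroup (CommutativeMonoid.commutativeSemigroup ∧-commutativeMonoid) using (x∙yz≈y∙xz)

T-does⇔ : ∀ {P : Set} (P? : Dec P) → T (does P?) ⇔ P
T-does⇔ (yes p) = mk⇔ (const p) (const tt)
T-does⇔ (no ¬p) = mk⇔ (λ ()) ¬p

module _ {A : Set} where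

  ∈-filterᵇ⁺ : ∀ {p : A → Bool} {xs x} → x ∈ xs → T (p x) → x ∈ filterᵇ p xs
  ∈-filterᵇ⁺ {p} = ∈-filter⁺ (T? ∘ p)

  ∈-filterᵇ⁻ : ∀ {p : A → Bool} {xs x} → x ∈ filterᵇ p xs → x ∈ xs × T (p x)
  ∈-filterᵇ⁻ {p} = ∈-filter⁻ (T? ∘ p)

  filterᵇ-unique : ∀ {p : A → Bool} {xs} → Unique xs → Unique (filterᵇ p xs)
  filterᵇ-unique {p} = Unique.filter⁺ (T? ∘ p)

  head≡just⇒∈ : ∀ {xs : List A} {x} → head xs ≡ just x → x ∈ xs
  head≡just⇒∈ {_ ∷ _} refl = here refl

  head≡nothing⇒≡[] : ∀ {xs : List A} → head xs ≡ nothing → xs ≡ []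
  head≡nothing⇒≡[] {[]} _ = refl

  unique-⇔⇒↭ : ∀ {xs ys : List A} → Unique xs → Unique ys →
    (∀ {z} → z ∈ xs ⇔ z ∈ ys) → xs ↭ ys
  unique-⇔⇒↭ u v eq = ∼bag⇒↭ (unique∧set⇒bag u v eq)

  length-filterᵇ-↔ : ∀ {xs : List A} → Unique xs → (∀ x → x ∈ xs) →
    (σ : A ↔ A) {p q : A → Bool} → (∀ x → q (Inverse.to σ x) ≡ p x) →
    length (filterᵇ p xs) ≡ length (filterᵇ q xs)
  length-filterᵇ-↔ {xs} unique complete σ {p} {q} q∘σ≗p = begin
    length (filterᵇ p xs)                ≡⟨ length-map to (filterᵇ p xs) ⟨
    length (map to (filterᵇ p xs))       ≡⟨ ↭-length (unique-⇔⇒↭ unique-image (filterᵇ-unique unique) (mk⇔ ⇒ ⇐)) ⟩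
    length (filterᵇ q xs)                ∎
    where
    open ≡-Reasoning
    open Inverse σ using (to; from; strictlyInverseˡ)
    unique-image : Unique (map to (filterᵇ p xs))
    unique-image = Unique.map⁺ (Injection.injective (↔⇒↣ σ)) (filterᵇ-unique unique)
    ⇒ : ∀ {z} → z ∈ map to (filterᵇ p xs) → z ∈ filterᵇ q xs
    ⇒ z∈ with ∈-map⁻ to z∈
    ... | x , x∈ , refl = ∈-filterᵇ⁺ (complete (to x)) (subst T (sym (q∘σ≗p x)) (proj₂ (∈-filterᵇ⁻ {p = p} {xs} x∈)))
    ⇐ : ∀ {z} → z ∈ filterᵇ q xs → z ∈ map to (filterᵇ p xs)
    ⇐ {z} z∈ = subst (_∈ map to (filterᵇ p xs)) (strictlyInverseˡ z)
      (∈-map⁺ to (∈-filterᵇ⁺ (complete (from z))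
        (subst T (trans (sym (cong q (strictlyInverseˡ z))) (q∘σ≗p (from z))) (proj₂ (∈-filterᵇ⁻ {p = q} {xs} z∈)))))

module Characteristic2
  {F : Set} {_+_ _*_ : F → F → F} { -_ : F → F } {0# 1# : F}
  (isCommutativeRing : IsCommutativeRing _≡_ _+_ _*_ -_ 0# 1#)
  (char2 : 1# + 1# ≡ 0#)
  where

  open IsCommutativeRing isCommutativeRing
    using (+-identityˡ; +-identityʳ; +-assoc; -‿inverseˡ; -‿inverseʳ; zeroˡ; *-identityˡ)

  commutativeRing : CommutativeRing 0ℓ 0ℓ
  commutativeRing = record { isCommutativeRing = isCommutativeRing }

  private
    -1≡1 : - 1# ≡ 1#
    -1≡1 = begin
      - 1#                 ≡⟨ +-identityʳ _ ⟨
      (- 1#) + 0#          ≡⟨ cong ((- 1#) +_) char2 ⟨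
      (- 1#) + (1# + 1#)   ≡⟨ +-assoc _ _ _ ⟨
      ((- 1#) + 1#) + 1#   ≡⟨ cong (_+ 1#) (-‿inverseˡ 1#) ⟩
      0# + 1#              ≡⟨ +-identityˡ _ ⟩
      1#                   ∎
      where open ≡-Reasoning

    𝔽₂ : RawRing 0ℓ 0ℓ
    𝔽₂ = record
      { Carrier = Bool ; _≈_ = _≡_ ; _+_ = _xor_ ; _*_ = _∧_ ; -_ = λ b → b
      ; 0# = false ; 1# = true }

    ⟦_⟧ : Bool → F
    ⟦ false ⟧ = 0#
    ⟦ true ⟧ = 1#

    homomorphism : 𝔽₂ -Raw-AlmostCommutative⟶ fromCommutativeRing commutativeRing
    homomorphism = record
      { ⟦_⟧ = ⟦_⟧ ; +-homo = +-homo ; *-homo = *-homo ; -‿homo = -‿homo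
      ; 0-homo = refl ; 1-homo = refl }
      where
      +-homo : ∀ a b → ⟦ a xor b ⟧ ≡ ⟦ a ⟧ + ⟦ b ⟧
      +-homo false b     = sym (+-identityˡ _)
      +-homo true  false = sym (+-identityʳ _)
      +-homo true  true  = sym char2
      *-homo : ∀ a b → ⟦ a ∧ b ⟧ ≡ ⟦ a ⟧ * ⟦ b ⟧
      *-homo false b = sym (zeroˡ _)
      *-homo true  b = sym (*-identityˡ _)
      -‿homo : ∀ a → ⟦ a ⟧ ≡ - ⟦ a ⟧
      -‿homo false = sym (trans (sym (+-identityˡ _)) (-‿inverseʳ 0#))
      -‿homo true  = sym -1≡1

    _≟𝔽₂_ : ∀ a b → Maybe (⟦ a ⟧ ≡ ⟦ b ⟧)
    false ≟𝔽₂ false = just refl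
    true  ≟𝔽₂ true  = just refl
    _     ≟𝔽₂ _     = nothing

  -- A ring solver with coefficients in 𝔽₂, so that it knows 1 + 1 = 0.
  open RingSolver 𝔽₂ (fromCommutativeRing commutativeRing) homomorphism _≟𝔽₂_ public
    using (solve; _:=_; _:+_; _:*_; con)

  x+x≡0 : ∀ x → x + x ≡ 0#
  x+x≡0 = solve 1 (λ x → x :+ x := con false) refl

  x+y≡0⇒x≡y : ∀ {x y} → x + y ≡ 0# → x ≡ y
  x+y≡0⇒x≡y {x} {y} x+y≡0 = begin
    x            ≡⟨ solve 2 (λ x y → x := y :+ (x :+ y)) refl x y ⟩
    y + (x + y)  ≡⟨ cong (y +_) x+y≡0 ⟩
    y + 0#       ≡⟨ +-identityʳ y ⟩
    y            ∎
    where open ≡-Reasoning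

  x≡y⇒x+y≡0 : ∀ {x y} → x ≡ y → x + y ≡ 0#
  x≡y⇒x+y≡0 {x} refl = x+x≡0 x

  sq-+ : ∀ x y → (x + y) * (x + y) ≡ (x * x) + (y * y)
  sq-+ = solve 2 (λ x y → (x :+ y) :* (x :+ y) := x :* x :+ y :* y) refl

module FiniteField {m : ℕ} (K : GF2^ m) where

  open GF2^ K
  open GF K using (_==_; sq; trAux; Tr)
  open Characteristic2 isCommutativeRing char2 public
  open IsCommutativeRing isCommutativeRing
    using (+-identityˡ; +-identityʳ; *-comm; *-assoc; *-identityˡ; *-identityʳ; zeroˡ; zeroʳ; *-isCommutativeMonoid)
  open CommutativeRing commutativeRing using (commutativeSemiring)
  open RawSemiring (CommutativeSemiring.rawSemiring commutativeSemiring) using (_^_)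
  open Exp commutativeSemiring using (^-homo-*; ^-distrib-*)
  open ≡-Reasoning

  x*y≡0⇒x≡0⊎y≡0 : ∀ {x y} → x * y ≡ 0# → x ≡ 0# ⊎ y ≡ 0#
  x*y≡0⇒x≡0⊎y≡0 {x} {y} xy≡0 with x ≟ 0#
  ... | yes x≡0 = inj₁ x≡0
  ... | no x≢0 with inverse x x≢0
  ... | x⁻¹ , xx⁻¹≡1 = inj₂ (begin
    y                                    ≡⟨ solve 3 (λ x y i → y := i :* (x :* y) :+ y :* (con true :+ x :* i)) refl x y x⁻¹ ⟩
    x⁻¹ * (x * y) + y * (1# + x * x⁻¹)   ≡⟨ cong₂ (λ u v → x⁻¹ * u + y * (1# + v)) xy≡0 xx⁻¹≡1 ⟩
    x⁻¹ * 0# + y * (1# + 1#)             ≡⟨ solve 2 (λ i y → i :* con false :+ y :* (con true :+ con true) := con false) refl x⁻¹ y ⟩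
    0#                                   ∎)

  *-inverseˡ : ∀ {x} → x ≢ 0# → ∃ λ x⁻¹ → x⁻¹ * x ≡ 1#
  *-inverseˡ {x} x≢0 with inverse x x≢0
  ... | x⁻¹ , xx⁻¹≡1 = x⁻¹ , trans (*-comm x⁻¹ x) xx⁻¹≡1

  *-cancelˡ : ∀ {a x y} → a ≢ 0# → a * x ≡ a * y → x ≡ y
  *-cancelˡ {a} {x} {y} a≢0 e with x*y≡0⇒x≡0⊎y≡0 (trans (solve 3 (λ a x y → a :* (x :+ y) := a :* x :+ a :* y) refl a x y) (x≡y⇒x+y≡0 e))
  ... | inj₁ a≡0   = ⊥-elim (a≢0 a≡0)
  ... | inj₂ x+y≡0 = x+y≡0⇒x≡y x+y≡0

  sq≡0⇒≡0 : ∀ {x} → sq x ≡ 0# → x ≡ 0#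
  sq≡0⇒≡0 x²≡0 with x*y≡0⇒x≡0⊎y≡0 x²≡0
  ... | inj₁ x≡0 = x≡0
  ... | inj₂ x≡0 = x≡0

  sq-injective : ∀ {x y} → sq x ≡ sq y → x ≡ y
  sq-injective {x} {y} e = x+y≡0⇒x≡y (sq≡0⇒≡0 (trans (sq-+ x y) (x≡y⇒x+y≡0 e)))

  nonzero : List F
  nonzero = filterᵇ (λ y → not (y == 0#)) elems

  ∈nonzero⇔≢0 : ∀ {x} → x ∈ nonzero ⇔ x ≢ 0#
  ∈nonzero⇔≢0 {x} = mk⇔
    (λ x∈ → Equivalence.to (T-does⇔ (¬? (x ≟ 0#))) (proj₂ (∈-filterᵇ⁻ {xs = elems} x∈)))
    (λ x≢0 → ∈-filterᵇ⁺ (complete x) (Equivalence.from (T-does⇔ (¬? (x ≟ 0#))) x≢0))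

  elems↭0∷nonzero : elems ↭ 0# ∷ nonzero
  elems↭0∷nonzero = unique-⇔⇒↭ unique (All.tabulate (λ x∈ → ≢-sym (Equivalence.to ∈nonzero⇔≢0 x∈)) ∷ filterᵇ-unique unique)
    (λ {x} → mk⇔ (λ _ → [ here , there ∘ Equivalence.from ∈nonzero⇔≢0 ]′ (Dec.toSum (x ≟ 0#))) (λ _ → complete x))

  suc-length-nonzero : suc (length nonzero) ≡ 2 ℕ.^ m
  suc-length-nonzero = trans (sym (↭-length elems↭0∷nonzero)) card

  product : List F → F
  product = foldr _*_ 1#

  product-↭ : ∀ {xs ys} → xs ↭ ys → product xs ≡ product ys
  product-↭ xs↭ys = Permutation.foldr-commMonoid (setoid F) *-isCommutativeMonoid (↭⇒↭ₛ xs↭ys)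

  product-map-* : ∀ a xs → product (map (a *_) xs) ≡ a ^ length xs * product xs
  product-map-* a [] = sym (*-identityʳ 1#)
  product-map-* a (x ∷ xs) = begin
    a * x * product (map (a *_) xs)          ≡⟨ cong (a * x *_) (product-map-* a xs) ⟩
    a * x * (a ^ length xs * product xs)     ≡⟨ solve 4 (λ a x p q → a :* x :* (p :* q) := a :* p :* (x :* q)) refl a x _ _ ⟩
    a * a ^ length xs * (x * product xs)     ∎

  product≢0 : ∀ xs → (∀ {z} → z ∈ xs → z ≢ 0#) → product xs ≢ 0#
  product≢0 [] _ 1≡0 = 0≢1 (sym 1≡0)
  product≢0 (x ∷ xs) ≢0 xΠ≡0 with x*y≡0⇒x≡0⊎y≡0 xΠ≡0
  ... | inj₁ x≡0 = ≢0 (here refl) x≡0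
  ... | inj₂ Π≡0 = product≢0 xs (≢0 ∘ there) Π≡0

  *-nonzero↭nonzero : ∀ {a} → a ≢ 0# → map (a *_) nonzero ↭ nonzero
  *-nonzero↭nonzero {a} a≢0 with inverse a a≢0
  ... | a⁻¹ , aa⁻¹≡1 = unique-⇔⇒↭ (Unique.map⁺ (*-cancelˡ a≢0) (filterᵇ-unique unique)) (filterᵇ-unique unique) (mk⇔ ⇒ ⇐)
    where
    a⁻¹-cancel : ∀ x → a * (a⁻¹ * x) ≡ x
    a⁻¹-cancel x = trans (sym (*-assoc a a⁻¹ x)) (trans (cong (_* x) aa⁻¹≡1) (*-identityˡ x))
    ⇒ : ∀ {z} → z ∈ map (a *_) nonzero → z ∈ nonzero
    ⇒ z∈ with ∈-map⁻ (a *_) z∈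
    ... | x , x∈ , refl = Equivalence.from ∈nonzero⇔≢0 ([ a≢0 , Equivalence.to ∈nonzero⇔≢0 x∈ ]′ ∘ x*y≡0⇒x≡0⊎y≡0)
    ⇐ : ∀ {z} → z ∈ nonzero → z ∈ map (a *_) nonzero
    ⇐ {z} z∈ = subst (_∈ map (a *_) nonzero) (a⁻¹-cancel z) (∈-map⁺ (a *_) (Equivalence.from ∈nonzero⇔≢0 a⁻¹z≢0))
      where
      a⁻¹z≢0 : a⁻¹ * z ≢ 0#
      a⁻¹z≢0 e = Equivalence.to ∈nonzero⇔≢0 z∈ (trans (sym (a⁻¹-cancel z)) (trans (cong (a *_) e) (zeroʳ a)))

  ^-length-nonzero≡1 : ∀ {a} → a ≢ 0# → a ^ length nonzero ≡ 1#
  ^-length-nonzero≡1 {a} a≢0 = *-cancelˡ Π≢0 (begin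
    product nonzero * a ^ length nonzero   ≡⟨ *-comm _ _ ⟩
    a ^ length nonzero * product nonzero   ≡⟨ product-map-* a nonzero ⟨
    product (map (a *_) nonzero)           ≡⟨ product-↭ (*-nonzero↭nonzero a≢0) ⟩
    product nonzero                        ≡⟨ *-identityʳ _ ⟨
    product nonzero * 1#                   ∎)
    where
    Π≢0 : product nonzero ≢ 0#
    Π≢0 = product≢0 nonzero (Equivalence.to ∈nonzero⇔≢0)

  x^[2^m]≡x : ∀ a → a ^ (2 ℕ.^ m) ≡ a
  x^[2^m]≡x a with a ≟ 0#
  ... | yes refl = subst (λ n → 0# ^ n ≡ 0#) suc-length-nonzero (zeroˡ _)
  ... | no a≢0   = subst (λ n → a ^ n ≡ a) suc-length-nonzero (trans (cong (a *_) (^-length-nonzero≡1 a≢0)) (*-identityʳ a))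

  iterate-sq≡^ : ∀ k x → iterate sq x k ≡ x ^ (2 ℕ.^ k)
  iterate-sq≡^ zero x = sym (*-identityʳ x)
  iterate-sq≡^ (suc k) x = begin
    iterate sq (x * x) k                   ≡⟨ iterate-sq≡^ k (x * x) ⟩
    (x * x) ^ (2 ℕ.^ k)                    ≡⟨ ^-distrib-* x x (2 ℕ.^ k) ⟩
    x ^ (2 ℕ.^ k) * x ^ (2 ℕ.^ k)          ≡⟨ ^-homo-* x (2 ℕ.^ k) (2 ℕ.^ k) ⟨
    x ^ (2 ℕ.^ k ℕ.+ 2 ℕ.^ k)              ≡⟨ cong (λ n → x ^ (2 ℕ.^ k ℕ.+ n)) (ℕ.+-identityʳ (2 ℕ.^ k)) ⟨
    x ^ (2 ℕ.^ suc k)                      ∎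

  frobenius-order : ∀ x → iterate sq x m ≡ x
  frobenius-order x = trans (iterate-sq≡^ m x) (x^[2^m]≡x x)

  sq-iterate-sq : ∀ k x → sq (iterate sq x k) ≡ iterate sq (sq x) k
  sq-iterate-sq zero    x = refl
  sq-iterate-sq (suc k) x = sq-iterate-sq k (sq x)

  trAux-+ : ∀ k x y → trAux k (x + y) ≡ trAux k x + trAux k y
  trAux-+ zero    x y = sym (+-identityʳ 0#)
  trAux-+ (suc k) x y = begin
    (x + y) + trAux k (sq (x + y))                  ≡⟨ cong (λ z → (x + y) + trAux k z) (sq-+ x y) ⟩
    (x + y) + trAux k (sq x + sq y)                 ≡⟨ cong ((x + y) +_) (trAux-+ k (sq x) (sq y)) ⟩
    (x + y) + (trAux k (sq x) + trAux k (sq y))     ≡⟨ solve 4 (λ x y a b → (x :+ y) :+ (a :+ b) := (x :+ a) :+ (y :+ b)) refl x y _ _ ⟩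
    (x + trAux k (sq x)) + (y + trAux k (sq y))     ∎

  sq-trAux : ∀ k x → sq (trAux k x) ≡ trAux k (sq x)
  sq-trAux zero    x = zeroˡ 0#
  sq-trAux (suc k) x = trans (sq-+ x _) (cong (sq x +_) (sq-trAux k (sq x)))

  trAux+trAux∘sq : ∀ k x → trAux k x + trAux k (sq x) ≡ x + iterate sq x k
  trAux+trAux∘sq zero    x = trans (+-identityʳ 0#) (sym (x+x≡0 x))
  trAux+trAux∘sq (suc k) x = begin
    (x + trAux k (sq x)) + (sq x + trAux k (sq (sq x)))    ≡⟨ solve 4 (λ x a s b → (x :+ a) :+ (s :+ b) := x :+ s :+ (a :+ b)) refl x _ _ _ ⟩
    x + sq x + (trAux k (sq x) + trAux k (sq (sq x)))      ≡⟨ cong (x + sq x +_) (trAux+trAux∘sq k (sq x)) ⟩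
    x + sq x + (sq x + iterate sq (sq x) k)                ≡⟨ solve 3 (λ x s t → x :+ s :+ (s :+ t) := x :+ t) refl x _ _ ⟩
    x + iterate sq (sq x) k                                ∎

  Tr-+ : ∀ x y → Tr (x + y) ≡ Tr x + Tr y
  Tr-+ = trAux-+ m

  Tr-sq : ∀ x → Tr (sq x) ≡ Tr x
  Tr-sq x = sym (x+y≡0⇒x≡y (trans (trAux+trAux∘sq m x) (trans (cong (x +_) (frobenius-order x)) (x+x≡0 x))))

  Tr-0 : Tr 0# ≡ 0#
  Tr-0 = trans (cong Tr (sym (+-identityˡ 0#))) (trans (Tr-+ 0# 0#) (x+x≡0 (Tr 0#)))

  Tr≡0⊎Tr≡1 : ∀ x → Tr x ≡ 0# ⊎ Tr x ≡ 1#
  Tr≡0⊎Tr≡1 x with x*y≡0⇒x≡0⊎y≡0 {Tr x} {Tr x + 1#}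
      (trans (solve 1 (λ t → t :* (t :+ con true) := t :* t :+ t) refl (Tr x))
             (x≡y⇒x+y≡0 (trans (sq-trAux m x) (Tr-sq x))))
  ... | inj₁ Tr≡0   = inj₁ Tr≡0
  ... | inj₂ Tr+1≡0 = inj₂ (x+y≡0⇒x≡y Tr+1≡0)

  Tr[x²+x]≡0 : ∀ x → Tr (sq x + x) ≡ 0#
  Tr[x²+x]≡0 x = trans (Tr-+ (sq x) x) (trans (cong (_+ Tr x) (Tr-sq x)) (x+x≡0 _))

  -- a₀ ∷ ⋯ ∷ a_{d-1} stands for the monic polynomial a₀ + a₁X + ⋯ + a_{d-1}X^{d-1} + X^d.
  evalᵐ : List F → F → F
  evalᵐ []      x = 1#
  evalᵐ (a ∷ p) x = a + x * evalᵐ p x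

  quotient : List F → F → List F
  quotient []      r = []
  quotient (b ∷ p) r = evalᵐ (b ∷ p) r ∷ quotient p r

  length-quotient : ∀ p r → length (quotient p r) ≡ length p
  length-quotient []      r = refl
  length-quotient (b ∷ p) r = cong suc (length-quotient p r)

  evalᵐ-quotient : ∀ a p r x → evalᵐ (a ∷ p) x ≡ evalᵐ (a ∷ p) r + (x + r) * evalᵐ (quotient p r) x
  evalᵐ-quotient a []      r x = solve 3 (λ a x r → a :+ x :* con true := (a :+ r :* con true) :+ (x :+ r) :* con true) refl a x r
  evalᵐ-quotient a (b ∷ p) r x = begin
    a + x * evalᵐ (b ∷ p) x            ≡⟨ cong (λ z → a + x * z) (evalᵐ-quotient b p r x) ⟩
    a + x * (E + (x + r) * Q)          ≡⟨ solve 5 (λ a x r E Q → a :+ x :* (E :+ (x :+ r) :* Q) := (a :+ r :* E) :+ (x :+ r) :* (E :+ x :* Q)) refl a x r E Q ⟩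
    (a + r * E) + (x + r) * (E + x * Q) ∎
    where
    E = evalᵐ (b ∷ p) r
    Q = evalᵐ (quotient p r) x

  roots≤degree : ∀ p {xs} → Unique xs → (∀ {z} → z ∈ xs → evalᵐ p z ≡ 0#) → length xs ≤ length p
  roots≤degree p       {[]}     _ _ = z≤n
  roots≤degree []      {r ∷ _}  _ root = ⊥-elim (0≢1 (sym (root (here refl))))
  roots≤degree (a ∷ p) {r ∷ rs} (r∉rs ∷ unique-rs) root =
    s≤s (subst (length rs ≤_) (length-quotient p r) (roots≤degree (quotient p r) unique-rs quotient-root))
    where
    quotient-root : ∀ {z} → z ∈ rs → evalᵐ (quotient p r) z ≡ 0#
    quotient-root {z} z∈rs with x*y≡0⇒x≡0⊎y≡0 {z + r} {evalᵐ (quotient p r) z} (begin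
      (z + r) * evalᵐ (quotient p r) z                       ≡⟨ +-identityˡ _ ⟨
      0# + (z + r) * evalᵐ (quotient p r) z                  ≡⟨ cong (_+ (z + r) * evalᵐ (quotient p r) z) (root (here refl)) ⟨
      evalᵐ (a ∷ p) r + (z + r) * evalᵐ (quotient p r) z     ≡⟨ evalᵐ-quotient a p r z ⟨
      evalᵐ (a ∷ p) z                                        ≡⟨ root (there z∈rs) ⟩
      0#                                                     ∎)
    ... | inj₁ z+r≡0 = ⊥-elim (All.lookup r∉rs z∈rs (sym (x+y≡0⇒x≡y z+r≡0)))
    ... | inj₂ Q≡0   = Q≡0

  spread : List F → List F
  spread []      = []
  spread (a ∷ p) = a ∷ 0# ∷ spread p

  evalᵐ-spread : ∀ p x → evalᵐ (spread p) x ≡ evalᵐ p (sq x)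
  evalᵐ-spread []      x = refl
  evalᵐ-spread (a ∷ p) x = begin
    a + x * (0# + x * evalᵐ (spread p) x)  ≡⟨ cong (λ z → a + x * (0# + x * z)) (evalᵐ-spread p x) ⟩
    a + x * (0# + x * evalᵐ p (sq x))      ≡⟨ solve 3 (λ a x E → a :+ x :* (con false :+ x :* E) := a :+ (x :* x) :* E) refl a x _ ⟩
    a + sq x * evalᵐ p (sq x)              ∎

  length-spread : ∀ p → length (spread p) ≡ 2 ℕ.* length p
  length-spread []      = refl
  length-spread (a ∷ p) = trans (cong (suc ∘ suc) (length-spread p)) (sym (ℕ.*-suc 2 (length p)))

  x+spread : List F → List F
  x+spread []      = 1# ∷ []
  x+spread (a ∷ p) = a ∷ 1# ∷ spread p

  evalᵐ-x+spread : ∀ p x → evalᵐ (x+spread p) x ≡ x + evalᵐ p (sq x)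
  evalᵐ-x+spread []      x = solve 1 (λ x → con true :+ x :* con true := x :+ con true) refl x
  evalᵐ-x+spread (a ∷ p) x = begin
    a + x * (1# + x * evalᵐ (spread p) x)  ≡⟨ cong (λ z → a + x * (1# + x * z)) (evalᵐ-spread p x) ⟩
    a + x * (1# + x * evalᵐ p (sq x))      ≡⟨ solve 3 (λ a x E → a :+ x :* (con true :+ x :* E) := x :+ (a :+ (x :* x) :* E)) refl a x _ ⟩
    x + (a + sq x * evalᵐ p (sq x))        ∎

  length-x+spread : ∀ p → length (x+spread p) ≤ suc (2 ℕ.* length p)
  length-x+spread []      = ℕ.≤-refl
  length-x+spread (a ∷ p) = ℕ.m≤n⇒m≤1+n (ℕ.≤-reflexive (length-spread (a ∷ p)))

  trPoly : ℕ → List F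
  trPoly zero    = 0# ∷ []
  trPoly (suc k) = x+spread (trPoly k)

  evalᵐ-trPoly : ∀ k x → evalᵐ (trPoly k) x ≡ trAux (suc k) x
  evalᵐ-trPoly zero    x = solve 1 (λ x → con false :+ x :* con true := x :+ con false) refl x
  evalᵐ-trPoly (suc k) x = trans (evalᵐ-x+spread (trPoly k) x) (cong (x +_) (evalᵐ-trPoly k (sq x)))

  length-trPoly : ∀ k → length (trPoly k) < 2 ℕ.^ suc k
  length-trPoly zero    = ℕ.≤-refl
  length-trPoly (suc k) = ℕ.≤-trans (s≤s (length-x+spread (trPoly k)))
    (subst (_≤ 2 ℕ.^ suc (suc k)) (ℕ.*-suc 2 (length (trPoly k))) (ℕ.*-monoʳ-≤ 2 (length-trPoly k)))

  m≢0 : m ≢ 0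
  m≢0 m≡0 = ℕ.<⇒≢ (s≤s (∈-length (Equivalence.from ∈nonzero⇔≢0 (≢-sym 0≢1)))) (sym (trans suc-length-nonzero (cong (2 ℕ.^_) m≡0)))

  m≡suc[pred-m] : m ≡ suc (ℕ.pred m)
  m≡suc[pred-m] = sym (ℕ.suc-pred m {{ℕ.≢-nonZero m≢0}})

  -- Otherwise every element of F would be a root of X + X² + ⋯ + X^(2^(m-1)).
  ∃Tr≡1 : ∃ λ t → Tr t ≡ 1#
  ∃Tr≡1 with any? (λ x → Tr x ≟ 1#) elems
  ... | yes some = Any.satisfied some
  ... | no none  = ⊥-elim (ℕ.<⇒≱ (length-trPoly (ℕ.pred m))
      (subst (_≤ length (trPoly (ℕ.pred m))) (trans card (cong (2 ℕ.^_) m≡suc[pred-m]))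
        (roots≤degree (trPoly (ℕ.pred m)) unique elems-are-roots)))
    where
    elems-are-roots : ∀ {z} → z ∈ elems → evalᵐ (trPoly (ℕ.pred m)) z ≡ 0#
    elems-are-roots {z} z∈ with Tr≡0⊎Tr≡1 z
    ... | inj₁ Tr≡0 = trans (evalᵐ-trPoly (ℕ.pred m) z) (subst (λ k → trAux k z ≡ 0#) m≡suc[pred-m] Tr≡0)
    ... | inj₂ Tr≡1 = ⊥-elim (none (lose z∈ Tr≡1))

  t₁ : F
  t₁ = proj₁ ∃Tr≡1

  Tr-t₁ : Tr t₁ ≡ 1#
  Tr-t₁ = proj₂ ∃Tr≡1

  -- artinSchreierSum m s t₁ 0# = Σ_{j<i<m} s^(2^i) t₁^(2^j), the classical solution of
  -- β² + β = s; at step i of the recursion u = t₁^(2^i) and T = Σ_{j<i} t₁^(2^j).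
  artinSchreierSum : ℕ → F → F → F → F
  artinSchreierSum zero    s u T = 0#
  artinSchreierSum (suc k) s u T = s * T + artinSchreierSum k (sq s) (sq u) (T + u)

  sq+artinSchreierSum : ∀ k s u T → sq T ≡ T + u + t₁ →
    let β = artinSchreierSum k s u T in
    sq β + β ≡ s * T + iterate sq s k * (T + trAux k u) + t₁ * trAux k (sq s)
  sq+artinSchreierSum zero s u T _ =
    solve 3 (λ s T t → con false :* con false :+ con false := s :* T :+ s :* (T :+ con false) :+ t :* con false) refl s T t₁
  sq+artinSchreierSum (suc k) s u T T²≡T+u+t₁ = begin
    sq (s * T + β) + (s * T + β)
      ≡⟨ solve 3 (λ s T B → (s :* T :+ B) :* (s :* T :+ B) :+ (s :* T :+ B) := (B :* B :+ B) :+ (s :* s :* (T :* T) :+ s :* T)) refl s T β ⟩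
    (sq β + β) + (s * s * (T * T) + s * T)
      ≡⟨ cong₂ (λ a b → a + (s * s * b + s * T)) (sq+artinSchreierSum k (sq s) (sq u) (T + u) invariant) T²≡T+u+t₁ ⟩
    (sq s * (T + u) + S * ((T + u) + R) + t₁ * W) + (s * s * (T + u + t₁) + s * T)
      ≡⟨ solve 7 (λ s T u t S R W → (s :* s :* (T :+ u) :+ S :* ((T :+ u) :+ R) :+ t :* W) :+ (s :* s :* (T :+ u :+ t) :+ s :* T)
                                   := s :* T :+ S :* (T :+ (u :+ R)) :+ t :* (s :* s :+ W)) refl s T u t₁ S R W ⟩
    s * T + S * (T + (u + R)) + t₁ * (sq s + W) ∎
    where
    β = artinSchreierSum k (sq s) (sq u) (T + u)
    S = iterate sq (sq s) k
    R = trAux k (sq u)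
    W = trAux k (sq (sq s))
    invariant : sq (T + u) ≡ (T + u) + sq u + t₁
    invariant = trans (sq-+ T u) (trans (cong (_+ sq u) T²≡T+u+t₁)
                  (solve 4 (λ T u t q → T :+ u :+ t :+ q := (T :+ u) :+ q :+ t) refl T u t₁ (sq u)))

  artinSchreier : ∀ {s} → Tr s ≡ 0# → ∃ λ β → sq β + β ≡ s
  artinSchreier {s} Tr-s≡0 = β , (begin
    sq β + β                                              ≡⟨ sq+artinSchreierSum m s t₁ 0# (solve 1 (λ t → con false :* con false := con false :+ t :+ t) refl t₁) ⟩
    s * 0# + iterate sq s m * (0# + Tr t₁) + t₁ * Tr (sq s) ≡⟨ cong₂ (λ a b → s * 0# + a * (0# + Tr t₁) + t₁ * b) (frobenius-order s) (trans (Tr-sq s) Tr-s≡0) ⟩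
    s * 0# + s * (0# + Tr t₁) + t₁ * 0#                   ≡⟨ cong (λ a → s * 0# + s * (0# + a) + t₁ * 0#) Tr-t₁ ⟩
    s * 0# + s * (0# + 1#) + t₁ * 0#                      ≡⟨ solve 2 (λ s t → s :* con false :+ s :* (con false :+ con true) :+ t :* con false := s) refl s t₁ ⟩
    s                                                     ∎)
    where
    β = artinSchreierSum m s t₁ 0#

  √ : F → F
  √ x = iterate sq x (ℕ.pred m)

  sq-√ : ∀ x → sq (√ x) ≡ x
  sq-√ x = trans (sq-iterate-sq (ℕ.pred m) x) (subst (λ k → iterate sq x k ≡ x) m≡suc[pred-m] (frobenius-order x))

module Geometry {m : ℕ} (K : GF2^ m) where

  open GF2^ K
  open GF K
  open FiniteField K
  open IsCommutativeRing isCommutativeRing using (+-identityˡ; +-identityʳ; *-comm; zeroˡ; zeroʳ)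
  open ≡-Reasoning

  q : Line → F
  q (x , y) = x * y

  ρ̂-sym : ∀ ℓ n → ρ̂ ℓ n ≡ ρ̂ n ℓ
  ρ̂-sym (x , y) (z , u) = solve 4 (λ x y z u →
    x :* x :* (u :* u) :+ y :* y :* (z :* z) :+ (x :+ z) :* (y :+ u)
    := z :* z :* (y :* y) :+ u :* u :* (x :* x) :+ (z :+ x) :* (u :+ y)) refl x y z u

  origin : Line
  origin = 0# , 0#

  ρ̂-origin : ∀ n → ρ̂ origin n ≡ q n
  ρ̂-origin (z , u) = solve 2 (λ z u →
    con false :* con false :* (u :* u) :+ con false :* con false :* (z :* z) :+ (con false :+ z) :* (con false :+ u)
    := z :* u) refl z u

  Tr-ρ̂ : ∀ ℓ n → Tr (ρ̂ ℓ n) ≡ Tr (q ℓ) + Tr (q n)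
  Tr-ρ̂ (x , y) (z , u) = begin
    Tr (ρ̂ (x , y) (z , u))              ≡⟨ cong Tr (solve 4 (λ x y z u →
        x :* x :* (u :* u) :+ y :* y :* (z :* z) :+ (x :+ z) :* (y :+ u)
        := ((x :* u :+ y :* z) :* (x :* u :+ y :* z) :+ (x :* u :+ y :* z)) :+ (x :* y :+ z :* u)) refl x y z u) ⟩
    Tr ((sq w + w) + (x * y + z * u))   ≡⟨ Tr-+ _ _ ⟩
    Tr (sq w + w) + Tr (x * y + z * u)  ≡⟨ cong₂ _+_ (Tr[x²+x]≡0 w) (Tr-+ _ _) ⟩
    0# + (Tr (x * y) + Tr (z * u))      ≡⟨ +-identityˡ _ ⟩
    Tr (x * y) + Tr (z * u)             ∎
    where
    w = x * u + y * z

  -- The action on 𝓛 of the stabiliser of 𝒪, through the only two properties the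
  -- argument uses: it preserves ρ̂ and each class 𝓛_ε. The generators scale, transpose
  -- and shear below are induced by the collineations (X,Y,Z) ↦ (X, ιY, αZ), (X, Z, Y)
  -- and (X + βZ, Y + β²Z, Z).
  record Symmetry : Set where
    field
      act            : Line ↔ Line
      ρ̂-invariant    : ∀ ℓ n → ρ̂ (Inverse.to act ℓ) (Inverse.to act n) ≡ ρ̂ ℓ n
      Tr∘q-invariant : ∀ ℓ → Tr (q (Inverse.to act ℓ)) ≡ Tr (q ℓ)

  open Symmetry

  infixr 9 _∘ₛ_
  infix  8 _·_

  _·_ : Symmetry → Line → Line
  σ · ℓ = Inverse.to (act σ) ℓ

  _∘ₛ_ : Symmetry → Symmetry → Symmetry
  σ ∘ₛ τ = record
    { act            = act σ ↔-∘ act τ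
    ; ρ̂-invariant    = λ ℓ n → trans (ρ̂-invariant σ (τ · ℓ) (τ · n)) (ρ̂-invariant τ ℓ n)
    ; Tr∘q-invariant = λ ℓ → trans (Tr∘q-invariant σ (τ · ℓ)) (Tr∘q-invariant τ ℓ)
    }

  _⁻¹ₛ : Symmetry → Symmetry
  σ ⁻¹ₛ = record
    { act            = ↔-sym (act σ)
    ; ρ̂-invariant    = λ ℓ n → trans (sym (ρ̂-invariant σ (from ℓ) (from n))) (cong₂ ρ̂ (strictlyInverseˡ ℓ) (strictlyInverseˡ n))
    ; Tr∘q-invariant = λ ℓ → trans (sym (Tr∘q-invariant σ (from ℓ))) (cong (Tr ∘ q) (strictlyInverseˡ ℓ))
    }
    where open Inverse (act σ) using (from; strictlyInverseˡ)

  ·-injective : ∀ σ {k l} → σ · k ≡ σ · l → k ≡ l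
  ·-injective σ = Injection.injective (↔⇒↣ (act σ))

  scale : ∀ α ι → α * ι ≡ 1# → Symmetry
  scale α ι αι≡1 = record
    { act            = mk↔ₛ′ (λ { (x , y) → α * x , ι * y }) (λ { (x , y) → ι * x , α * y })
                             (λ { (x , y) → cong₂ _,_ (cancel α ι αι≡1 x) (cancel ι α ια≡1 y) })
                             (λ { (x , y) → cong₂ _,_ (cancel ι α ια≡1 x) (cancel α ι αι≡1 y) })
    ; ρ̂-invariant    = λ { (x , y) (z , u) → begin
        ρ̂ (α * x , ι * y) (α * z , ι * u)   ≡⟨ solve 6 (λ a i x y z u →
            (a :* x) :* (a :* x) :* ((i :* u) :* (i :* u)) :+ (i :* y) :* (i :* y) :* ((a :* z) :* (a :* z)) :+ (a :* x :+ a :* z) :* (i :* y :+ i :* u)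
            := (a :* i) :* (a :* i) :* (x :* x :* (u :* u) :+ y :* y :* (z :* z)) :+ (a :* i) :* ((x :+ z) :* (y :+ u))) refl α ι x y z u ⟩
        (α * ι) * (α * ι) * V x y z u + (α * ι) * W x y z u   ≡⟨ cong (λ k → k * k * V x y z u + k * W x y z u) αι≡1 ⟩
        1# * 1# * V x y z u + 1# * W x y z u                  ≡⟨ solve 2 (λ V W → con true :* con true :* V :+ con true :* W := V :+ W) refl _ _ ⟩
        ρ̂ (x , y) (z , u)                                     ∎ }
    ; Tr∘q-invariant = λ { (x , y) → cong Tr (trans (solve 4 (λ a i x y → (a :* x) :* (i :* y) := (a :* i) :* (x :* y)) refl α ι x y)
                                                   (trans (cong (_* (x * y)) αι≡1) (*-identityˡ _))) }
    }
    where
    open IsCommutativeRing isCommutativeRing using (*-identityˡ)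
    ια≡1 = trans (*-comm ι α) αι≡1
    cancel : ∀ a b → a * b ≡ 1# → ∀ x → a * (b * x) ≡ x
    cancel a b ab≡1 x = trans (solve 3 (λ a b x → a :* (b :* x) := (a :* b) :* x) refl a b x) (trans (cong (_* x) ab≡1) (*-identityˡ x))
    V W : F → F → F → F → F
    V x y z u = x * x * (u * u) + y * y * (z * z)
    W x y z u = (x + z) * (y + u)

  transpose : Symmetry
  transpose = record
    { act            = mk↔ₛ′ swap swap (λ _ → refl) (λ _ → refl)
    ; ρ̂-invariant    = λ { (x , y) (z , u) → solve 4 (λ x y z u →
        y :* y :* (z :* z) :+ x :* x :* (u :* u) :+ (y :+ u) :* (x :+ z)
        := x :* x :* (u :* u) :+ y :* y :* (z :* z) :+ (x :+ z) :* (y :+ u)) refl x y z u }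
    ; Tr∘q-invariant = λ { (x , y) → cong Tr (*-comm y x) }
    }

  shear : F → Symmetry
  shear β = record
    { act            = mk↔ₛ′ shearβ shearβ involutive involutive
    ; ρ̂-invariant    = λ { (x , y) (z , u) → solve 5 (λ x y z u b →
        x :* x :* ((z :* (b :* b) :+ b :+ u) :* (z :* (b :* b) :+ b :+ u)) :+ (x :* (b :* b) :+ b :+ y) :* (x :* (b :* b) :+ b :+ y) :* (z :* z)
          :+ (x :+ z) :* ((x :* (b :* b) :+ b :+ y) :+ (z :* (b :* b) :+ b :+ u))
        := x :* x :* (u :* u) :+ y :* y :* (z :* z) :+ (x :+ z) :* (y :+ u)) refl x y z u β }
    ; Tr∘q-invariant = λ { (x , y) → begin
        Tr (x * (x * sq β + β + y))          ≡⟨ cong Tr (solve 3 (λ x y b → x :* (x :* (b :* b) :+ b :+ y) := ((x :* b) :* (x :* b) :+ x :* b) :+ x :* y) refl x y β) ⟩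
        Tr ((sq (x * β) + x * β) + x * y)    ≡⟨ Tr-+ _ _ ⟩
        Tr (sq (x * β) + x * β) + Tr (x * y) ≡⟨ cong (_+ Tr (x * y)) (Tr[x²+x]≡0 (x * β)) ⟩
        0# + Tr (x * y)                      ≡⟨ +-identityˡ _ ⟩
        Tr (x * y)                           ∎ }
    }
    where
    shearβ : Line → Line
    shearβ (x , y) = x , x * sq β + β + y
    involutive : ∀ ℓ → shearβ (shearβ ℓ) ≡ ℓ
    involutive (x , y) = cong (x ,_) (solve 3 (λ x y b → x :* (b :* b) :+ b :+ (x :* (b :* b) :+ b :+ y) := y) refl x y β)

  infix 4 _∼_

  _∼_ : Line × Line → Line × Line → Set
  (ℓ , n) ∼ (ℓ′ , n′) = Σ Symmetry λ σ → σ · ℓ ≡ ℓ′ × σ · n ≡ n′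

  ∼-sym : ∀ {P P′} → P ∼ P′ → P′ ∼ P
  ∼-sym (σ , refl , refl) = σ ⁻¹ₛ , strictlyInverseʳ _ , strictlyInverseʳ _
    where open Inverse (act σ) using (strictlyInverseʳ)

  ∼-trans : ∀ {P P′ P″} → P ∼ P′ → P′ ∼ P″ → P ∼ P″
  ∼-trans (σ , refl , refl) (τ , refl , refl) = τ ∘ₛ σ , refl , refl

  ⟦_⟧ : Sign → F
  ⟦ pos ⟧ = 0#
  ⟦ neg ⟧ = 1#

  Pair : F → Sign → Line × Line → Set
  Pair c ε (ℓ , n) = ℓ ≢ n × Tr (q ℓ) ≡ ⟦ ε ⟧ × ρ̂ ℓ n ≡ c

  secant↦origin : ∀ ℓ → Tr (q ℓ) ≡ 0# → Σ Symmetry λ σ → σ · ℓ ≡ origin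
  secant↦origin (x , y) Tr≡0 with x ≟ 0#
  ... | yes refl = shear y , cong (0# ,_) (solve 1 (λ y → con false :* (y :* y) :+ y :+ y := con false) refl y)
  ... | no x≢0 with *-inverseˡ x≢0 | artinSchreier Tr≡0
  ... | x⁻¹ , x⁻¹x≡1 | β , β²+β≡xy =
    transpose ∘ₛ shear 1# ∘ₛ transpose ∘ₛ shear β ∘ₛ scale x⁻¹ x x⁻¹x≡1 ,
    cong₂ _,_ (trans (cong₂ (λ c a → c * (1# * 1#) + 1# + a) first≡0 x⁻¹x≡1)
                     (solve 0 (con false :* (con true :* con true) :+ con true :+ con true := con false) refl))
              first≡0
    where
    first≡0 : x⁻¹ * x * sq β + β + x * y ≡ 0#
    first≡0 = begin
      x⁻¹ * x * sq β + β + x * y   ≡⟨ cong (λ a → a * sq β + β + x * y) x⁻¹x≡1 ⟩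
      1# * sq β + β + x * y        ≡⟨ solve 3 (λ b c d → con true :* b :+ c :+ d := (b :+ c) :+ d) refl (sq β) β (x * y) ⟩
      (sq β + β) + x * y           ≡⟨ cong (_+ x * y) β²+β≡xy ⟩
      x * y + x * y                ≡⟨ x+x≡0 (x * y) ⟩
      0#                           ∎

  origin-stabiliser : ∀ n → n ≢ origin → Σ Symmetry λ σ → σ · origin ≡ origin × σ · n ≡ (1# , q n)
  origin-stabiliser (z , u) n≢o with z ≟ 0#
  ... | no z≢0 with *-inverseˡ z≢0
  ... | z⁻¹ , z⁻¹z≡1 = scale z⁻¹ z z⁻¹z≡1 , cong₂ _,_ (zeroʳ z⁻¹) (zeroʳ z) , cong (_, z * u) z⁻¹z≡1
  origin-stabiliser (z , u) n≢o | yes refl with u ≟ 0#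
  ... | yes refl = ⊥-elim (n≢o refl)
  ... | no u≢0 with *-inverseˡ u≢0
  ... | u⁻¹ , u⁻¹u≡1 = scale u⁻¹ u u⁻¹u≡1 ∘ₛ transpose , cong₂ _,_ (zeroʳ u⁻¹) (zeroʳ u) ,
                       cong₂ _,_ u⁻¹u≡1 (trans (zeroʳ u) (sym (zeroˡ u)))

  secantPair∼ : ∀ {c ℓ n} → Pair c pos (ℓ , n) → (ℓ , n) ∼ (origin , (1# , c))
  secantPair∼ {c} {ℓ} {n} (ℓ≢n , Tr≡0 , ρ̂≡c) with secant↦origin ℓ Tr≡0
  ... | σ , σℓ≡o with origin-stabiliser (σ · n) (λ e → ℓ≢n (·-injective σ (trans σℓ≡o (sym e))))
  ... | τ , τo≡o , τσn≡1,qσn = τ ∘ₛ σ , trans (cong (τ ·_) σℓ≡o) τo≡o , trans τσn≡1,qσn (cong (1# ,_) qσn≡c)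
    where
    qσn≡c : q (σ · n) ≡ c
    qσn≡c = begin
      q (σ · n)             ≡⟨ ρ̂-origin _ ⟨
      ρ̂ origin (σ · n)      ≡⟨ cong (λ l → ρ̂ l (σ · n)) σℓ≡o ⟨
      ρ̂ (σ · ℓ) (σ · n)     ≡⟨ ρ̂-invariant σ ℓ n ⟩
      ρ̂ ℓ n                 ≡⟨ ρ̂≡c ⟩
      c                     ∎

  equaliseFirst : ∀ ℓ n → Σ Symmetry λ σ → proj₁ (σ · ℓ) ≡ proj₁ (σ · n)
  equaliseFirst (x , y) (z , u) with y ≟ u
  ... | yes refl = transpose , refl
  ... | no y≢u with *-inverseˡ (y≢u ∘ x+y≡0⇒x≡y)
  ... | ι , ι[y+u]≡1 = transpose ∘ₛ shear β ∘ₛ transpose , x+y≡0⇒x≡y (begin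
    (y * sq β + β + x) + (u * sq β + β + z)   ≡⟨ solve 5 (λ x y z u b → (y :* (b :* b) :+ b :+ x) :+ (u :* (b :* b) :+ b :+ z) := (y :+ u) :* (b :* b) :+ (x :+ z)) refl x y z u β ⟩
    (y + u) * sq β + (x + z)                  ≡⟨ cong (λ t → (y + u) * t + (x + z)) (sq-√ _) ⟩
    (y + u) * ((x + z) * ι) + (x + z)         ≡⟨ solve 3 (λ d s i → d :* (s :* i) :+ s := s :* (i :* d) :+ s) refl (y + u) (x + z) ι ⟩
    (x + z) * (ι * (y + u)) + (x + z)         ≡⟨ cong (λ t → (x + z) * t + (x + z)) ι[y+u]≡1 ⟩
    (x + z) * 1# + (x + z)                    ≡⟨ solve 1 (λ s → s :* con true :+ s := con false) refl (x + z) ⟩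
    0#                                        ∎)
    where
    β = √ ((x + z) * ι)

  exterior-sameFirst : ∀ ℓ n → proj₁ ℓ ≡ proj₁ n → Tr (q ℓ) ≡ 1# →
    Σ Symmetry λ σ → σ · ℓ ≡ (1# , t₁) × σ · n ≡ (1# , t₁ + √ (ρ̂ ℓ n))
  exterior-sameFirst (w , a) (.w , b) refl Tr≡1 with w ≟ 0#
  ... | yes refl = ⊥-elim (0≢1 (trans (sym Tr-0) (trans (cong Tr (sym (zeroˡ a))) Tr≡1)))
  ... | no w≢0 with *-inverseˡ w≢0 | artinSchreier {w * a + t₁} (trans (Tr-+ _ _) (trans (cong₂ _+_ Tr≡1 Tr-t₁) char2))
  ... | w⁻¹ , w⁻¹w≡1 | β , β²+β≡wa+t₁ =
    shear β ∘ₛ scale w⁻¹ w w⁻¹w≡1 ,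
    cong₂ _,_ w⁻¹w≡1 (trans (shifted (w * a)) (solve 2 (λ A t → (A :+ t) :+ A := t) refl (w * a) t₁)) ,
    cong₂ _,_ w⁻¹w≡1 (trans (shifted (w * b)) (trans (solve 3 (λ A t B → (A :+ t) :+ B := t :+ (A :+ B)) refl (w * a) t₁ (w * b))
                                                     (cong (t₁ +_) (sym √ρ̂≡wa+wb))))
    where
    shifted : ∀ C → w⁻¹ * w * sq β + β + C ≡ (w * a + t₁) + C
    shifted C = begin
      w⁻¹ * w * sq β + β + C   ≡⟨ cong (λ k → k * sq β + β + C) w⁻¹w≡1 ⟩
      1# * sq β + β + C        ≡⟨ solve 3 (λ b c d → con true :* b :+ c :+ d := (b :+ c) :+ d) refl (sq β) β C ⟩
      (sq β + β) + C           ≡⟨ cong (_+ C) β²+β≡wa+t₁ ⟩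
      (w * a + t₁) + C         ∎
    √ρ̂≡wa+wb : √ (ρ̂ (w , a) (w , b)) ≡ w * a + w * b
    √ρ̂≡wa+wb = sq-injective (trans (sq-√ _) (solve 3 (λ w a b →
      w :* w :* (b :* b) :+ a :* a :* (w :* w) :+ (w :+ w) :* (a :+ b) := (w :* a :+ w :* b) :* (w :* a :+ w :* b)) refl w a b))

  exteriorPair∼ : ∀ {c ℓ n} → Pair c neg (ℓ , n) → (ℓ , n) ∼ ((1# , t₁) , (1# , t₁ + √ c))
  exteriorPair∼ {c} {ℓ} {n} (_ , Tr≡1 , ρ̂≡c) with equaliseFirst ℓ n
  ... | σ , sameFirst with exterior-sameFirst (σ · ℓ) (σ · n) sameFirst (trans (Tr∘q-invariant σ ℓ) Tr≡1)
  ... | τ , τσℓ≡ , τσn≡ = τ ∘ₛ σ , τσℓ≡ , trans τσn≡ (cong (λ r → 1# , t₁ + √ r) (trans (ρ̂-invariant σ ℓ n) ρ̂≡c))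

  Pair-∼ : ∀ {c} ε {P P′} → Pair c ε P → Pair c ε P′ → P ∼ P′
  Pair-∼ pos h h′ = ∼-trans (secantPair∼ h) (∼-sym (secantPair∼ h′))
  Pair-∼ neg h h′ = ∼-trans (exteriorPair∼ h) (∼-sym (exteriorPair∼ h′))

  ⟦⟧-injective : ∀ {ε ε′} → ⟦ ε ⟧ ≡ ⟦ ε′ ⟧ → ε ≡ ε′
  ⟦⟧-injective {pos} {pos} _   = refl
  ⟦⟧-injective {pos} {neg} 0≡1 = ⊥-elim (0≢1 0≡1)
  ⟦⟧-injective {neg} {pos} 1≡0 = ⊥-elim (0≢1 (sym 1≡0))
  ⟦⟧-injective {neg} {neg} _   = refl

  ⟦opposite⟧ : ∀ ε → ⟦ opposite ε ⟧ ≡ 1# + ⟦ ε ⟧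
  ⟦opposite⟧ pos = sym (+-identityʳ 1#)
  ⟦opposite⟧ neg = sym char2

  ⟦ε′⟧ : ∀ c ε → ⟦ ε′ c ε ⟧ ≡ Tr c + ⟦ ε ⟧
  ⟦ε′⟧ c ε with Tr≡0⊎Tr≡1 c
  ... | inj₁ Tr≡0 rewrite dec-true (Tr c ≟ 0#) Tr≡0 = sym (trans (cong (_+ ⟦ ε ⟧) Tr≡0) (+-identityˡ _))
  ... | inj₂ Tr≡1 rewrite dec-false (Tr c ≟ 0#) (λ Tr≡0 → 0≢1 (trans (sym Tr≡0) Tr≡1)) =
    trans (⟦opposite⟧ ε) (cong (_+ ⟦ ε ⟧) (sym Tr≡1))

  ε′-involutive : ∀ c ε → ε′ c (ε′ c ε) ≡ ε
  ε′-involutive c ε = ⟦⟧-injective (begin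
    ⟦ ε′ c (ε′ c ε) ⟧      ≡⟨ ⟦ε′⟧ c (ε′ c ε) ⟩
    Tr c + ⟦ ε′ c ε ⟧      ≡⟨ cong (Tr c +_) (⟦ε′⟧ c ε) ⟩
    Tr c + (Tr c + ⟦ ε ⟧)  ≡⟨ solve 2 (λ t e → t :+ (t :+ e) := e) refl (Tr c) ⟦ ε ⟧ ⟩
    ⟦ ε ⟧                  ∎)

  Pair-swap : ∀ {c ε ℓ n} → Pair c ε (ℓ , n) → Pair c (ε′ c ε) (n , ℓ)
  Pair-swap {c} {ε} {ℓ} {n} (ℓ≢n , Trqℓ≡ε , ρ̂≡c) = ≢-sym ℓ≢n , Trqn≡ε′ , trans (ρ̂-sym n ℓ) ρ̂≡c
    where
    Trqn≡ε′ : Tr (q n) ≡ ⟦ ε′ c ε ⟧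
    Trqn≡ε′ = begin
      Tr (q n)                          ≡⟨ solve 2 (λ a b → b := (a :+ b) :+ a) refl (Tr (q ℓ)) (Tr (q n)) ⟩
      (Tr (q ℓ) + Tr (q n)) + Tr (q ℓ)  ≡⟨ cong₂ _+_ (trans (sym (Tr-ρ̂ ℓ n)) (cong Tr ρ̂≡c)) Trqℓ≡ε ⟩
      Tr c + ⟦ ε ⟧                      ≡⟨ ⟦ε′⟧ c ε ⟨
      ⟦ ε′ c ε ⟧                        ∎

  _≟L_ : (k l : Line) → Dec (k ≡ l)
  (x , y) ≟L (z , u) = Dec.map′ (uncurry (cong₂ _,_)) (λ e → cong proj₁ e , cong proj₂ e) ((x ≟ z) ×-dec (y ≟ u))

  ==L-invariant : ∀ σ k l → ((σ · k) ==L (σ · l)) ≡ (k ==L l)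
  ==L-invariant σ k l = does-⇔ (mk⇔ (·-injective σ) (cong (σ ·_))) ((σ · k) ≟L (σ · l)) (k ≟L l)

  lines-unique : Unique lines
  lines-unique = Unique.cartesianProduct⁺ unique unique

  lines-complete : ∀ ℓ → ℓ ∈ lines
  lines-complete (x , y) = ∈-cartesianProduct⁺ (complete x) (complete y)

  Invariant : (Line → Line → ℕ) → Set
  Invariant N = ∀ σ ℓ n → N (σ · ℓ) (σ · n) ≡ N ℓ n

  countπ-invariant : ∀ a b → Invariant (countπ a b)
  countπ-invariant a b σ ℓ n = sym (length-filterᵇ-↔ lines-unique lines-complete (act σ) λ k →
    cong₂ (λ u v → (u == a) ∧ (v == b)) (ρ̂-invariant σ ℓ k) (ρ̂-invariant σ k n))

  countp-invariant : ∀ a b → Invariant (countp a b)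
  countp-invariant a b σ ℓ n = sym (length-filterᵇ-↔ lines-unique lines-complete (act σ) λ k →
    cong₂ _∧_ (cong (_== a) (ρ̂-invariant σ ℓ k)) (cong₂ _∧_ (cong (_== b) (ρ̂-invariant σ k n))
      (cong₂ (λ u v → not u ∧ not v) (==L-invariant σ k ℓ) (==L-invariant σ k n))))

  countπ-swap : ∀ a b ℓ n → countπ a b ℓ n ≡ countπ b a n ℓ
  countπ-swap a b ℓ n = length-filterᵇ-↔ lines-unique lines-complete (↔-id Line) λ k →
    trans (cong₂ (λ u v → (u == b) ∧ (v == a)) (ρ̂-sym n k) (ρ̂-sym k ℓ)) (∧-comm (ρ̂ k n == b) (ρ̂ ℓ k == a))

  countp-swap : ∀ a b ℓ n → countp a b ℓ n ≡ countp b a n ℓ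
  countp-swap a b ℓ n = length-filterᵇ-↔ lines-unique lines-complete (↔-id Line) λ k → begin
    (ρ̂ n k == b) ∧ (ρ̂ k ℓ == a) ∧ not (k ==L n) ∧ not (k ==L ℓ)
      ≡⟨ cong₂ (λ u v → (u == b) ∧ (v == a) ∧ not (k ==L n) ∧ not (k ==L ℓ)) (ρ̂-sym n k) (ρ̂-sym k ℓ) ⟩
    (ρ̂ k n == b) ∧ (ρ̂ ℓ k == a) ∧ not (k ==L n) ∧ not (k ==L ℓ)
      ≡⟨ cong (λ r → (ρ̂ k n == b) ∧ (ρ̂ ℓ k == a) ∧ r) (∧-comm (not (k ==L n)) (not (k ==L ℓ))) ⟩
    (ρ̂ k n == b) ∧ (ρ̂ ℓ k == a) ∧ not (k ==L ℓ) ∧ not (k ==L n)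
      ≡⟨ x∙yz≈y∙xz (ρ̂ k n == b) (ρ̂ ℓ k == a) _ ⟩
    (ρ̂ ℓ k == a) ∧ (ρ̂ k n == b) ∧ not (k ==L ℓ) ∧ not (k ==L n) ∎

  pair? : ∀ c ε P → Dec (Pair c ε P)
  pair? c ε (ℓ , n) = ¬? (ℓ ≟L n) ×-dec (Tr (q ℓ) ≟ ⟦ ε ⟧) ×-dec (ρ̂ ℓ n ≟ c)

  inClass≡does : ∀ ℓ ε → inClass ℓ ε ≡ does (Tr (q ℓ) ≟ ⟦ ε ⟧)
  inClass≡does ℓ pos = refl
  inClass≡does ℓ neg = refl

  T[chosen]⇔Pair : ∀ c ε ℓ n → T (not (ℓ ==L n) ∧ inClass ℓ ε ∧ (ρ̂ ℓ n == c)) ⇔ Pair c ε (ℓ , n)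
  T[chosen]⇔Pair c ε ℓ n
    rewrite inClass≡does ℓ ε = T-does⇔ (pair? c ε (ℓ , n))

  chosenPair-just : ∀ c ε {P} → chosenPair c ε ≡ just P → Pair c ε P
  chosenPair-just c ε {ℓ , n} e =
    Equivalence.to (T[chosen]⇔Pair c ε ℓ n) (proj₂ (∈-filterᵇ⁻ {xs = cartesianProduct lines lines} (head≡just⇒∈ e)))

  chosenPair-nothing : ∀ c ε {P} → chosenPair c ε ≡ nothing → ¬ Pair c ε P
  chosenPair-nothing c ε {ℓ , n} e h with head≡nothing⇒≡[] e
  ... | filtered≡[] with subst ((ℓ , n) ∈_) filtered≡[]
         (∈-filterᵇ⁺ (∈-cartesianProduct⁺ (lines-complete ℓ) (lines-complete n)) (Equivalence.from (T[chosen]⇔Pair c ε ℓ n) h))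
  ... | ()

  atChosenPair : (Line → Line → ℕ) → F → Sign → ℕ
  atChosenPair N c ε = maybe′ (uncurry N) 0 (chosenPair c ε)

  π≡atChosenPair : ∀ a b c ε → π a b c ε ≡ atChosenPair (countπ a b) c ε
  π≡atChosenPair a b c ε with chosenPair c ε
  ... | just _  = refl
  ... | nothing = refl

  p≡atChosenPair : ∀ a b c ε → p a b c ε ≡ atChosenPair (countp a b) c ε
  p≡atChosenPair a b c ε with chosenPair c ε
  ... | just _  = refl
  ... | nothing = refl

  atChosenPair-swap : ∀ (N N′ : Line → Line → ℕ) → (∀ ℓ n → N ℓ n ≡ N′ n ℓ) → Invariant N′ →
    ∀ c ε → atChosenPair N c ε ≡ atChosenPair N′ c (ε′ c ε)
  atChosenPair-swap N N′ N≡N′∘swap N′-invariant c ε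
    with chosenPair c ε in e₁ | chosenPair c (ε′ c ε) in e₂
  ... | just (ℓ , n) | just (ℓ′ , n′) = begin
    N ℓ n     ≡⟨ N≡N′∘swap ℓ n ⟩
    N′ n ℓ    ≡⟨ ∼-invariant (Pair-∼ (ε′ c ε) (Pair-swap (chosenPair-just c ε e₁)) (chosenPair-just c (ε′ c ε) e₂)) ⟩
    N′ ℓ′ n′  ∎
    where
    ∼-invariant : ∀ {P P′} → P ∼ P′ → uncurry N′ P ≡ uncurry N′ P′
    ∼-invariant {ℓ , n} (σ , refl , refl) = sym (N′-invariant σ ℓ n)
  ... | just (ℓ , n) | nothing = ⊥-elim (chosenPair-nothing c (ε′ c ε) e₂ (Pair-swap (chosenPair-just c ε e₁)))
  ... | nothing | just (ℓ′ , n′) =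
    ⊥-elim (chosenPair-nothing c ε e₁ (subst (λ ε″ → Pair c ε″ (n′ , ℓ′)) (ε′-involutive c ε) (Pair-swap (chosenPair-just c (ε′ c ε) e₂))))
  ... | nothing | nothing = refl

mainTheorem13 : {m : ℕ} (K : GF2^ m) (a b c : GF2^.F K) (ε : Sign) →
    (GF.π K a b c ε ≡ GF.π K b a c (GF.ε′ K c ε))
    × (GF.p K a b c ε ≡ GF.p K b a c (GF.ε′ K c ε))
mainTheorem13 K a b c ε =
  (begin
    π a b c ε                                   ≡⟨ π≡atChosenPair a b c ε ⟩
    atChosenPair (countπ a b) c ε               ≡⟨ atChosenPair-swap (countπ a b) (countπ b a) (countπ-swap a b) (countπ-invariant b a) c ε ⟩
    atChosenPair (countπ b a) c (ε′ c ε)        ≡⟨ π≡atChosenPair b a c (ε′ c ε) ⟨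
    π b a c (ε′ c ε)                            ∎) ,
  (begin
    p a b c ε                                   ≡⟨ p≡atChosenPair a b c ε ⟩
    atChosenPair (countp a b) c ε               ≡⟨ atChosenPair-swap (countp a b) (countp b a) (countp-swap a b) (countp-invariant b a) c ε ⟩
    atChosenPair (countp b a) c (ε′ c ε)        ≡⟨ p≡atChosenPair b a c (ε′ c ε) ⟨
    p b a c (ε′ c ε)                            ∎)
  where
  open GF K
  open Geometry K
  open ≡-Reasoning
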